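{- Let $T$ be a finite Church-Rosser Thue system over $\Sigma$ and let $u_1,\dots,u_n$ be strings, irreducible modulo $T$, lying in $L$, such that $L=[u_1]_T\cup\dots\cup[u_n]_T$. If $x\in\Sigma^*$ is unmixed, then $x$ is irreducible modulo $T$.
   Context: $\Sigma=\{a,b,\overline{a},\overline{b}\}$; $a,b$ are positive letters and $\overline{a},\overline{b}$ negative letters. A string is mixed if it contains both a positive and a negative letter, otherwise unmixed. $\lambda$ is the empty string. $S$ is the Thue system with rules $(a\overline{a},\lambda),(\overline{a}a,\lambda),(a\overline{b},\lambda),(\overline{b}a,\lambda),(b\overline{a},\lambda),(\overline{a}b,\lambda),(b\overline{b},\lambda),(\overline{b}b,\lambda),(a,b),(b,a),(\overline{a},\overline{b}),(\overline{b},\overline{a})$, and $L=[\lambda]_S$, the set of strings with equally many positive as negative letters. For a Thue system $T$ (pairs $(u,w)$ with $|u|\ge|w|$): $x\leftrightarrow_T y$ if $x=tuv$, $y=twv$ with $(u,w)$ or $(w,u)\in T$; $\overset{*}{\leftrightarrow}_T$ its reflexive-transitive closure; $[x]_T$ the class of $x$; $x\to_T y$ means $x\leftrightarrow_T y$ with $|x|>|y|$; a string is irreducible modulo $T$ if no $\to_T$ step applies to it. $T$ is Church-Rosser if $x\overset{*}{\leftrightarrow}_T y$ implies a common $z$ with $x\overset{*}{\to}_T z$, $y\overset{*}{\to}_T z$. -}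

module Defs where

open import Data.List using (List; []; _∷_; _++_; length)
open import Data.List.Membership.Propositional using (_∈_)
open import Data.List.Relation.Unary.All using (All)
open import Data.List.Relation.Unary.Any using (Any)
open import Data.Product using (_×_; _,_; ∃; ∃-syntax)
open import Data.Sum using (_⊎_)
open import Data.Nat using (_≥_; _>_)
open import Data.Empty using (⊥)
open import Relation.Nullary using (¬_)
open import Relation.Binary.PropositionalEquality using (_≡_)
open import Relation.Binary.Construct.Closure.ReflexiveTransitive using (Star)

data Letter : Set where
  a b a̅ b̅ : Letter

Str : Set
Str = List Letter

λ-str : Str
λ-str = []

data Positive : Letter → Set where
  pos-a : Positive a
  pos-b : Positive b

data Negative : Letter → Set where
  neg-a : Negative a̅
  neg-b : Negative b̅

Mixed : Str → Set
Mixed x = Any Positive x × Any Negative x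

Unmixed : Str → Set
Unmixed x = ¬ Mixed x

ThueSystem : Set
ThueSystem = List (Str × Str)

LengthOK : ThueSystem → Set
LengthOK T = All (λ r → length (Data.Product.proj₁ r) ≥ length (Data.Product.proj₂ r)) T
  where import Data.Product

_⊢_↔_ : ThueSystem → Str → Str → Set
T ⊢ x ↔ y = ∃[ t ] ∃[ u ] ∃[ w ] ∃[ v ]
  ( ((u , w) ∈ T ⊎ (w , u) ∈ T)
  × x ≡ t ++ u ++ v × y ≡ t ++ w ++ v )

_⊢_↔*_ : ThueSystem → Str → Str → Set
T ⊢ x ↔* y = Star (T ⊢_↔_) x y

InClass : ThueSystem → Str → Str → Set
InClass T x y = T ⊢ x ↔* y

_⊢_⟶_ : ThueSystem → Str → Str → Set
T ⊢ x ⟶ y = (T ⊢ x ↔ y) × length x > length y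

_⊢_⟶*_ : ThueSystem → Str → Str → Set
T ⊢ x ⟶* y = Star (T ⊢_⟶_) x y

Irreducible : ThueSystem → Str → Set
Irreducible T x = ∀ y → ¬ (T ⊢ x ⟶ y)

ChurchRosser : ThueSystem → Set
ChurchRosser T = ∀ x y → T ⊢ x ↔* y → ∃[ z ] (T ⊢ x ⟶* z × T ⊢ y ⟶* z)

S : ThueSystem
S = (a ∷ a̅ ∷ [] , []) ∷ (a̅ ∷ a ∷ [] , []) ∷ (a ∷ b̅ ∷ [] , []) ∷ (b̅ ∷ a ∷ [] , [])
  ∷ (b ∷ a̅ ∷ [] , []) ∷ (a̅ ∷ b ∷ [] , []) ∷ (b ∷ b̅ ∷ [] , []) ∷ (b̅ ∷ b ∷ [] , [])
  ∷ (a ∷ [] , b ∷ []) ∷ (b ∷ [] , a ∷ []) ∷ (a̅ ∷ [] , b̅ ∷ []) ∷ (b̅ ∷ [] , a̅ ∷ []) ∷ []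

InL : Str → Set
InL x = InClass S λ-str x

-- Let the weight of a string be its number of positive minus its number of
-- negative letters; S preserves weight, so strings in L have weight 0. For a
-- rule (l, r) of T, the string l c with c the formal inverse of l lies in L,
-- and since L is a union of T-classes so does r c; hence weight l = weight r.
-- An unmixed l has |weight l| = |l|, while |weight r| ≤ |r|, so no rule with
-- an unmixed left side shortens a string.
module Submission where

open import Defs
open import Data.Nat using (ℕ)
open import Data.Fin using (Fin)
open import Data.Product using (∃-syntax)
open import Function.Bundles using (_⇔_)

open import Algebra.Bundles using (AbelianGroup)
open import Data.Empty using (⊥-elim)
open import Data.Integer using (ℤ; +_; -_; ∣_∣; _+_)
import Data.Integer.Properties as ℤ
open import Algebra.Properties.Group (AbelianGroup.group ℤ.+-0-abelianGroup)
  using (∙-cancelʳ)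
open import Data.List using (List; []; _∷_; _++_; length)
open import Data.List.Properties using (length-++; ++-assoc)
open import Data.List.Membership.Propositional using (_∈_)
open import Data.List.Relation.Unary.All as All using (All; []; _∷_)
open import Data.List.Relation.Unary.Any using (Any; here; there; any?)
open import Data.List.Relation.Unary.Any.Properties using (++⁺ˡ; ++⁺ʳ)
open import Data.Nat as ℕ using (suc; s≤s; _≤_; _<_)
import Data.Nat.Properties as ℕₚ
open import Data.Product using (_,_; uncurry)
open import Data.Sum using (_⊎_; inj₂; [_,_]′)
open import Function.Bundles using (module Equivalence)
open import Relation.Binary.Construct.Closure.ReflexiveTransitive
  using (ε; _◅_; _◅◅_; gmap; fold)
open import Relation.Binary.PropositionalEquality
open import Relation.Nullary using (yes; no; ¬_)
open import Relation.Unary using (Decidable)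
open import Function using (_∘_)

length-infix-< : ∀ {A : Set} (t : List A) {u w} v →
                 length (t ++ u ++ v) < length (t ++ w ++ v) → length u < length w
length-infix-< t {u} {w} v lt =
  ℕₚ.+-cancelʳ-< (length v) (length u) (length w)
    (ℕₚ.+-cancelˡ-< (length t) _ _
      (subst₂ _<_ (length-infix t u v) (length-infix t w v) lt))
  where
  length-infix : ∀ t u v → length (t ++ u ++ v) ≡ length t ℕ.+ (length u ℕ.+ length v)
  length-infix t u v = trans (length-++ t) (cong (length t ℕ.+_) (length-++ u))

↔-infix : ∀ {T x y} c d → T ⊢ x ↔ y → T ⊢ (c ++ x ++ d) ↔ (c ++ y ++ d)
↔-infix c d (t , u , w , v , rule , refl , refl) =
  c ++ t , u , w , v ++ d , rule , regroup u , regroup w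
  where
  regroup : ∀ z → c ++ (t ++ z ++ v) ++ d ≡ (c ++ t) ++ z ++ v ++ d
  regroup z = begin
    c ++ (t ++ z ++ v) ++ d   ≡⟨ cong (c ++_) (++-assoc t (z ++ v) d) ⟩
    c ++ t ++ (z ++ v) ++ d   ≡⟨ cong (λ s → c ++ t ++ s) (++-assoc z v d) ⟩
    c ++ t ++ z ++ v ++ d     ≡⟨ ++-assoc c t (z ++ v ++ d) ⟨
    (c ++ t) ++ z ++ v ++ d   ∎
    where open ≡-Reasoning

↔*-infix : ∀ {T x y} c d → T ⊢ x ↔* y → T ⊢ (c ++ x ++ d) ↔* (c ++ y ++ d)
↔*-infix c d = gmap (λ z → c ++ z ++ d) (↔-infix c d)

letterWeight : Letter → ℤ
letterWeight a = + 1
letterWeight b = + 1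
letterWeight a̅ = - + 1
letterWeight b̅ = - + 1

weight : Str → ℤ
weight []      = + 0
weight (p ∷ x) = letterWeight p + weight x

weight-++ : ∀ x y → weight (x ++ y) ≡ weight x + weight y
weight-++ []      y = sym (ℤ.+-identityˡ (weight y))
weight-++ (p ∷ x) y = trans (cong (_+_ (letterWeight p)) (weight-++ x y))
                            (sym (ℤ.+-assoc (letterWeight p) (weight x) (weight y)))

weight-infix : ∀ t {u w} v → weight u ≡ weight w →
               weight (t ++ u ++ v) ≡ weight (t ++ w ++ v)
weight-infix t {u} {w} v u≡w = begin
  weight (t ++ u ++ v)             ≡⟨ weight-++ t (u ++ v) ⟩
  weight t + weight (u ++ v)       ≡⟨ cong (_+_ (weight t)) (weight-++ u v) ⟩
  weight t + (weight u + weight v) ≡⟨ cong (λ z → weight t + (z + weight v)) u≡w ⟩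
  weight t + (weight w + weight v) ≡⟨ cong (_+_ (weight t)) (weight-++ w v) ⟨
  weight t + weight (w ++ v)       ≡⟨ weight-++ t (w ++ v) ⟨
  weight (t ++ w ++ v)             ∎
  where open ≡-Reasoning

∣letterWeight+i∣≤1+∣i∣ : ∀ p i → ∣ letterWeight p + i ∣ ≤ suc ∣ i ∣
∣letterWeight+i∣≤1+∣i∣ a = ℤ.∣i+j∣≤∣i∣+∣j∣ (+ 1)
∣letterWeight+i∣≤1+∣i∣ b = ℤ.∣i+j∣≤∣i∣+∣j∣ (+ 1)
∣letterWeight+i∣≤1+∣i∣ a̅ = ℤ.∣i+j∣≤∣i∣+∣j∣ (- + 1)
∣letterWeight+i∣≤1+∣i∣ b̅ = ℤ.∣i+j∣≤∣i∣+∣j∣ (- + 1)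

∣weight∣≤length : ∀ x → ∣ weight x ∣ ≤ length x
∣weight∣≤length []      = ℕₚ.≤-refl
∣weight∣≤length (p ∷ x) =
  ℕₚ.≤-trans (∣letterWeight+i∣≤1+∣i∣ p (weight x)) (s≤s (∣weight∣≤length x))

weight-positive : ∀ x → ¬ Any Negative x → weight x ≡ + length x
weight-positive []      _      = refl
weight-positive (a ∷ x) no-neg = cong (_+_ (+ 1)) (weight-positive x (no-neg ∘ there))
weight-positive (b ∷ x) no-neg = cong (_+_ (+ 1)) (weight-positive x (no-neg ∘ there))
weight-positive (a̅ ∷ x) no-neg = ⊥-elim (no-neg (here neg-a))
weight-positive (b̅ ∷ x) no-neg = ⊥-elim (no-neg (here neg-b))

weight-negative : ∀ x → ¬ Any Positive x → weight x ≡ - + length x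
weight-negative []      _      = refl
weight-negative (a ∷ x) no-pos = ⊥-elim (no-pos (here pos-a))
weight-negative (b ∷ x) no-pos = ⊥-elim (no-pos (here pos-b))
weight-negative (a̅ ∷ x) no-pos = trans (cong (_+_ (- + 1)) (weight-negative x (no-pos ∘ there)))
                                       (sym (ℤ.neg-distrib-+ (+ 1) (+ length x)))
weight-negative (b̅ ∷ x) no-pos = trans (cong (_+_ (- + 1)) (weight-negative x (no-pos ∘ there)))
                                       (sym (ℤ.neg-distrib-+ (+ 1) (+ length x)))

positive? : Decidable Positive
positive? a = yes pos-a
positive? b = yes pos-b
positive? a̅ = no λ ()
positive? b̅ = no λ ()

∣weight∣-unmixed : ∀ x → Unmixed x → ∣ weight x ∣ ≡ length x
∣weight∣-unmixed x unmixed with any? positive? x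
... | yes pos = cong ∣_∣ (weight-positive x λ neg → unmixed (pos , neg))
... | no ¬pos = trans (cong ∣_∣ (weight-negative x ¬pos)) (ℤ.∣-i∣≡∣i∣ (+ length x))

unmixed-infix : ∀ t {u} v → Unmixed (t ++ u ++ v) → Unmixed u
unmixed-infix t v unmixed (pos , neg) = unmixed (++⁺ʳ t (++⁺ˡ pos) , ++⁺ʳ t (++⁺ˡ neg))

S-rules-preserve-weight : All (uncurry λ u w → weight u ≡ weight w) S
S-rules-preserve-weight =
  refl ∷ refl ∷ refl ∷ refl ∷ refl ∷ refl ∷ refl ∷ refl ∷ refl ∷ refl ∷ refl ∷ refl ∷ []

↔S-preserves-weight : ∀ {x y} → S ⊢ x ↔ y → weight x ≡ weight y
↔S-preserves-weight (t , u , w , v , rule , refl , refl) =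
  weight-infix t v ([ All.lookup S-rules-preserve-weight
                    , sym ∘ All.lookup S-rules-preserve-weight ]′ rule)

InL⇒weight≡0 : ∀ {x} → InL x → weight x ≡ + 0
InL⇒weight≡0 λ↔*x =
  sym (fold (λ x y → weight x ≡ weight y) (trans ∘ ↔S-preserves-weight) refl λ↔*x)

_⁻¹ : Letter → Letter
a ⁻¹ = a̅
b ⁻¹ = b̅
a̅ ⁻¹ = a
b̅ ⁻¹ = b

cancellation-rule : ∀ p → (p ∷ p ⁻¹ ∷ [] , []) ∈ S
cancellation-rule a = here refl
cancellation-rule a̅ = there (here refl)
cancellation-rule b = there (there (there (there (there (there (here refl))))))
cancellation-rule b̅ = there (there (there (there (there (there (there (here refl)))))))

inverse : Str → Str
inverse []      = []
inverse (p ∷ x) = inverse x ++ p ⁻¹ ∷ []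

InL-++-inverse : ∀ x → InL (x ++ inverse x)
InL-++-inverse []      = ε
InL-++-inverse (p ∷ x) =
  subst (λ z → InL (p ∷ z)) (++-assoc x (inverse x) (p ⁻¹ ∷ []))
    (insert ◅ ↔*-infix (p ∷ []) (p ⁻¹ ∷ []) (InL-++-inverse x))
  where
  insert : S ⊢ [] ↔ (p ∷ p ⁻¹ ∷ [])
  insert = [] , [] , p ∷ p ⁻¹ ∷ [] , [] , inj₂ (cancellation-rule p) , refl , refl

rule-preserves-weight : ∀ {T l r} → (∀ {x y} → InL x → T ⊢ x ↔ y → InL y) →
                        (l , r) ∈ T ⊎ (r , l) ∈ T → weight l ≡ weight r
rule-preserves-weight {l = l} {r} L-closed rule =
  ∙-cancelʳ (weight c) (weight l) (weight r) (begin
    weight l + weight c ≡⟨ weight-++ l c ⟨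
    weight (l ++ c)     ≡⟨ InL⇒weight≡0 lc∈L ⟩
    + 0                 ≡⟨ InL⇒weight≡0 (L-closed lc∈L ([] , l , r , c , rule , refl , refl)) ⟨
    weight (r ++ c)     ≡⟨ weight-++ r c ⟩
    weight r + weight c ∎)
  where
  open ≡-Reasoning
  c : Str
  c = inverse l
  lc∈L : InL (l ++ c)
  lc∈L = InL-++-inverse l

mainTheorem6 : (T : ThueSystem) → LengthOK T → ChurchRosser T →
    (n : ℕ) (u : Fin n → Str) →
    (∀ i → Irreducible T (u i)) → (∀ i → InL (u i)) →
    (∀ x → InL x ⇔ (∃[ i ] InClass T (u i) x)) →
    ∀ x → Unmixed x → Irreducible T x
mainTheorem6 T _ _ _ _ _ _ L⇔classes _ unmixed _
             ((t , l , r , v , rule , refl , refl) , shrinks) =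
  ℕₚ.<⇒≱ (length-infix-< t v shrinks) (begin
    length l     ≡⟨ ∣weight∣-unmixed l (unmixed-infix t v unmixed) ⟨
    ∣ weight l ∣ ≡⟨ cong ∣_∣ (rule-preserves-weight L-closed rule) ⟩
    ∣ weight r ∣ ≤⟨ ∣weight∣≤length r ⟩
    length r     ∎)
  where
  open ℕₚ.≤-Reasoning
  L-closed : ∀ {x y} → InL x → T ⊢ x ↔ y → InL y
  L-closed {x} {y} x∈L x↔y with Equivalence.to (L⇔classes x) x∈L
  ... | i , uᵢ↔*x = Equivalence.from (L⇔classes y) (i , uᵢ↔*x ◅◅ (x↔y ◅ ε))
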